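{- Let $n$ be a positive integer, let $m_1,\ldots,m_n$ be nonnegative integers, and let $\mathbf{C}$ be a subset of $[m_1]_0\times[m_2]_0\times\cdots\times[m_n]_0$ such that, for each $i\in[n]$, if $u_i>0$ for some $\mathbf{u}\in\mathbf{C}$, then $m_i=\max\{u_i:\mathbf{u}\in\mathbf{C}\}$. Then $\mathbf{C}$ is the set of circuits of an integer polymatroid on $E=[n]$ if and only if $\mathbf{C}$ satisfies: (C1) each vector in $\mathbf{C}$ has at least two positive entries; (C2) if $\mathbf{u},\mathbf{v}\in\mathbf{C}$ with $\mathbf{u}\ne\mathbf{v}$, then $\mathbf{u}\not<\mathbf{v}$ and $\mathbf{v}\not<\mathbf{u}$; (C3) if $\mathbf{u},\mathbf{v}\in\mathbf{C}$ with $\mathbf{u}\neq\mathbf{v}$ and $u_i,v_i>0$, then there is $\mathbf{z}\in\mathbf{C}$ with $\mathbf{z}<\mathbf{u}\vee\mathbf{v}$ and $z_i<\max(u_i,v_i)$; (C4) if $\mathbf{u}\in\mathbf{C}$, $i\in E$ with $0<u_i<m_i$, and $j\in E-\{i\}$ with $0<u_j$, then there is $\mathbf{v}\in\mathbf{C}$ with $v_i=u_i+1$, $v_h\le u_h$ for all $h\ne i$, and $v_j<u_j$. Moreover, when (C1)–(C4) hold, there is exactly one integer polymatroid $\rho$ on $[n]$ with $\rho(\{i\})=m_i$ for all $i\in[n]$ whose set of circuits is $\mathbf{C}$.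
   Context: An integer polymatroid on a finite set $E$ is a function $\rho:2^E\to\mathbb{N}$ with $\rho(\emptyset)=0$, monotone ($A\subseteq B\Rightarrow\rho(A)\le\rho(B)$) and submodular ($\rho(A\cup B)+\rho(A\cap B)\le\rho(A)+\rho(B)$). For $m\in\mathbb{N}$, $[m]_0=\{0,1,\ldots,m\}$; $[n]=\{1,\ldots,n\}$. For $\mathbf{u},\mathbf{v}\in\mathbb{N}^n$: $\mathbf{u}\le\mathbf{v}$ means $u_i\le v_i$ for all $i$; $\mathbf{u}<\mathbf{v}$ means $\mathbf{u}\le\mathbf{v}$ and $\mathbf{u}\ne\mathbf{v}$; $\mathbf{u}\vee\mathbf{v}$ is the componentwise maximum. For $X\subseteq[n]$, $|\mathbf{u}|_X=\sum_{i\in X}u_i$. For an integer polymatroid $\rho$ on $[n]$, a vector $\mathbf{u}\in\mathbb{N}^n$ is independent if $|\mathbf{u}|_X\le\rho(X)$ for all $X\subseteq[n]$; with $\mathbf{U}=[\rho(\{1\})]_0\times\cdots\times[\rho(\{n\})]_0$, a circuit of $\rho$ is a vector $\mathbf{u}\in\mathbf{U}$ that is not independent but every $\mathbf{w}<\mathbf{u}$ is independent. -}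

module Defs where

open import Data.Nat using (ℕ; zero; suc; _+_; _≤_; _<_; _⊔_)
open import Data.Bool using (true; false)
open import Data.Fin using (Fin)
open import Data.Fin.Subset using (Subset; _∪_; _∩_; _⊆_; ⁅_⁆) renaming (⊥ to ∅)
open import Data.Vec using (Vec; []; _∷_; lookup; zipWith)
open import Data.List using (List)
open import Data.List.Membership.Propositional using (_∈_)
open import Data.Product using (_×_; Σ; ∃; ∃-syntax; _,_)
open import Relation.Binary.PropositionalEquality using (_≡_; _≢_)
open import Relation.Nullary using (¬_)

record IsIntPolymatroid {n : ℕ} (ρ : Subset n → ℕ) : Set where
  field
    empty      : ρ ∅ ≡ 0
    monotone   : ∀ A B → A ⊆ B → ρ A ≤ ρ B
    submodular : ∀ A B → ρ (A ∪ B) + ρ (A ∩ B) ≤ ρ A + ρ B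

sumOn : ∀ {n} → Subset n → Vec ℕ n → ℕ
sumOn []          []       = 0
sumOn (true ∷ X)  (u ∷ us) = u + sumOn X us
sumOn (false ∷ X) (u ∷ us) = sumOn X us

_≤ᵥ_ : ∀ {n} → Vec ℕ n → Vec ℕ n → Set
u ≤ᵥ v = ∀ i → lookup u i ≤ lookup v i

_<ᵥ_ : ∀ {n} → Vec ℕ n → Vec ℕ n → Set
u <ᵥ v = u ≤ᵥ v × u ≢ v

_∨ᵥ_ : ∀ {n} → Vec ℕ n → Vec ℕ n → Vec ℕ n
u ∨ᵥ v = zipWith _⊔_ u v

Independent : ∀ {n} → (Subset n → ℕ) → Vec ℕ n → Set
Independent ρ u = ∀ X → sumOn X u ≤ ρ X

InBox : ∀ {n} → (Subset n → ℕ) → Vec ℕ n → Set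
InBox ρ u = ∀ i → lookup u i ≤ ρ ⁅ i ⁆

IsCircuit : ∀ {n} → (Subset n → ℕ) → Vec ℕ n → Set
IsCircuit ρ u = InBox ρ u × ¬ Independent ρ u × (∀ w → w <ᵥ u → Independent ρ w)

CircuitsAre : ∀ {n} → (Subset n → ℕ) → List (Vec ℕ n) → Set
CircuitsAre ρ C = ∀ u → (u ∈ C → IsCircuit ρ u) × (IsCircuit ρ u → u ∈ C)

C1 : ∀ {n} → List (Vec ℕ n) → Set
C1 {n} C = ∀ u → u ∈ C → Σ (Fin n) λ i → Σ (Fin n) λ j →
  i ≢ j × 0 < lookup u i × 0 < lookup u j

C2 : ∀ {n} → List (Vec ℕ n) → Set
C2 C = ∀ u v → u ∈ C → v ∈ C → u ≢ v → ¬ (u <ᵥ v) × ¬ (v <ᵥ u)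

C3 : ∀ {n} → List (Vec ℕ n) → Set
C3 C = ∀ u v → u ∈ C → v ∈ C → u ≢ v → ∀ i → 0 < lookup u i → 0 < lookup v i →
  ∃[ z ] (z ∈ C × z <ᵥ (u ∨ᵥ v) × lookup z i < lookup u i ⊔ lookup v i)

C4 : ∀ {n} → Vec ℕ n → List (Vec ℕ n) → Set
C4 m C = ∀ u → u ∈ C → ∀ i → 0 < lookup u i → lookup u i < lookup m i →
  ∀ j → j ≢ i → 0 < lookup u j →
  ∃[ v ] (v ∈ C × lookup v i ≡ suc (lookup u i)
          × (∀ h → h ≢ i → lookup v h ≤ lookup u h) × lookup v j < lookup u j)

-- If u is a circuit and ρ X < |u|_X, then X contains the support of u, since
-- lowering u outside X would keep the inequality violated.  (C1) and (C2) follow from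
-- dependence and minimality.  For (C3), adding the violated inequalities of u and v and using
-- submodularity shows that (u ∨ v) − eᵢ is still dependent; for (C4), moving one unit of u
-- from j to i does not change |u|_X.  Either way the new vector lies above a circuit.
--
-- Call a vector of the box below m independent when no member of C lies below
-- it.  By (C3) and (C4), for independent w at most one member of C lies below w + eₑ, and an
-- exchange argument built on this gives the augmentation property of independent vectors.
-- Hence ρ X = max {|u|_X : u independent} is an integer polymatroid.  Its circuits are C: a
-- member c of C is ρ-dependent, because extending c − eⱼ within the support of c to size |c|
-- would contradict (C4).  A polymatroid ρ′ with the same circuits and ρ′{i} = mᵢ has the same
-- independent vectors, and each value ρ′ X is attained by a greedily built one, so ρ′ = ρ.

module Submission where

open import Defs
open import Data.Bool using (true; false; if_then_else_; _∨_; _∧_)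
open import Data.Empty using (⊥; ⊥-elim)
open import Data.Fin using (Fin; zero; suc; punchIn; _≟_)
open import Data.Fin.Properties using (punchInᵢ≢i; ¬∀⟶∃¬)
import Data.Fin.Properties as Fin
open import Data.Fin.Subset using (Subset; Empty; _∪_; _∩_; _⊆_; ⁅_⁆; _∉_; _-_)
  renaming (⊥ to ∅; _∈_ to _∈ₛ_; ∣_∣ to ∣_∣ₛ)
open import Data.Fin.Subset.Properties
  using (_∈?_; x∈⁅x⁆; x∈⁅y⁆⇒x≡y; ∉⊥; anySubset?; x∈p∪q⁺; x∈p∩q⁺; p∩q⊆p; p─q⊆p;
         x∈p∧x≢y⇒x∈p-y; x∈p⇒∣p-x∣<∣p∣; nonempty?; Empty-unique)
open import Data.List using (List; []; _∷_; upTo; cartesianProductWith; filter)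
open import Data.List.Extrema.Nat using (argmax; argmax-all; f[xs]≤f[argmax])
open import Data.List.Membership.Propositional using (_∈_; find; lose)
open import Data.List.Membership.Propositional.Properties
  using (∈-cartesianProductWith⁺; ∈-upTo⁺; ∈-filter⁺)
import Data.List.Relation.Unary.All as All
open import Data.List.Relation.Unary.All.Properties using (all-filter)
open import Data.List.Relation.Unary.Any as Any using (Any; here)
open import Data.Nat
  using (ℕ; zero; suc; pred; _+_; _∸_; _≤_; _<_; _⊔_; _⊓_; _<ᵇ_; _≤?_; _<?_;
         >-nonZero; z≤n; s≤s; s≤s⁻¹)
open import Data.Nat.Induction using (<-wellFounded)
open import Data.Nat.Properties renaming (_≟_ to _≟ℕ_)
open import Data.Nat.Solver using (module +-*-Solver)
open import Algebra.Properties.CommutativeMonoid.Sum +-0-commutativeMonoid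
  using (sum; sum-cong-≗; sum-remove; sum-replicate-zero; ∑-distrib-+)
open import Data.Product using (_×_; Σ; ∃-syntax; _,_; proj₁; proj₂)
open import Data.Sum using (inj₁; inj₂)
open import Data.Vec using (Vec; []; _∷_; there; lookup; updateAt; replicate; tabulate; zipWith; _[_]≔_)
open import Data.Vec.Properties
  using (≡-dec; lookup∘updateAt; lookup∘updateAt′; lookup-replicate; lookup-zipWith;
         lookup∘tabulate; tabulate∘lookup; tabulate-cong; []=⇒lookup; lookup⇒[]=)
open import Function using (_∘_; case_of_)
open import Induction.WellFounded using (Acc; acc)
open import Relation.Binary.PropositionalEquality
  using (_≡_; _≢_; refl; sym; trans; cong; cong₂; subst; module ≡-Reasoning)
open import Relation.Nullary using (¬_; Dec; yes; no)
open import Relation.Nullary.Decidable using (decidable-stable; ¬?; _×-dec_)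

open +-*-Solver using (solve; _:=_; _:+_)

sum-mono-≤ : ∀ {n} {f g : Fin n → ℕ} → (∀ k → f k ≤ g k) → sum f ≤ sum g
sum-mono-≤ {zero}  f≤g = z≤n
sum-mono-≤ {suc n} f≤g = +-mono-≤ (f≤g zero) (sum-mono-≤ (f≤g ∘ suc))

sum-mono-< : ∀ {n} {f g : Fin n → ℕ} i → (∀ k → f k ≤ g k) → f i < g i → sum f < sum g
sum-mono-< zero    f≤g fi<gi = +-mono-<-≤ fi<gi (sum-mono-≤ (f≤g ∘ suc))
sum-mono-< (suc i) f≤g fi<gi = +-mono-≤-< (f≤g zero) (sum-mono-< i (f≤g ∘ suc) fi<gi)

sum-<⇒∃< : ∀ {n} (f g : Fin n → ℕ) → sum f < sum g → ∃[ k ] f k < g k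
sum-<⇒∃< {zero}  f g ()
sum-<⇒∃< {suc n} f g lt with f zero <? g zero
... | yes f0<g0 = zero , f0<g0
... | no  f0≮g0 =
  let k , fk<gk = sum-<⇒∃< (f ∘ suc) (g ∘ suc)
                    (+-cancelˡ-< (f zero) _ _ (<-≤-trans lt (+-monoˡ-≤ _ (≮⇒≥ f0≮g0))))
  in suc k , fk<gk

sum-zero : ∀ {n} (f : Fin n → ℕ) → (∀ k → f k ≡ 0) → sum f ≡ 0
sum-zero {n} f f≡0 = trans (sum-cong-≗ f≡0) (sum-replicate-zero n)

sum-exchange : ∀ {n} (f g : Fin n → ℕ) i → (∀ k → k ≢ i → f k ≡ g k) →
               sum f + g i ≡ sum g + f i
sum-exchange {suc n} f g i f≗g = begin
  sum f + g i                              ≡⟨ cong (_+ g i) (sum-remove {i = i} f) ⟩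
  f i + sum (f ∘ punchIn i) + g i          ≡⟨ cong (λ s → f i + s + g i) rest ⟩
  f i + sum (g ∘ punchIn i) + g i          ≡⟨ swap (f i) _ (g i) ⟩
  g i + sum (g ∘ punchIn i) + f i          ≡⟨ cong (_+ f i) (sum-remove {i = i} g) ⟨
  sum g + f i                              ∎
  where
  open ≡-Reasoning
  rest : sum (f ∘ punchIn i) ≡ sum (g ∘ punchIn i)
  rest = sum-cong-≗ (λ k → f≗g (punchIn i k) (punchInᵢ≢i i k))
  swap : ∀ a s b → a + s + b ≡ b + s + a
  swap = solve 3 (λ a s b → a :+ s :+ b := b :+ s :+ a) refl

sum-single : ∀ {n} (f : Fin n → ℕ) i → (∀ k → k ≢ i → f k ≡ 0) → sum f ≡ f i
sum-single {suc n} f i f≡0 = begin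
  sum f                            ≡⟨ sum-remove {i = i} f ⟩
  f i + sum (f ∘ punchIn i)        ≡⟨ cong (f i +_) (sum-zero _ (λ k → f≡0 _ (punchInᵢ≢i i k))) ⟩
  f i + 0                          ≡⟨ +-identityʳ (f i) ⟩
  f i                              ∎
  where open ≡-Reasoning

m<m⊔n⇒m<n : ∀ {m n} → m < m ⊔ n → m < n
m<m⊔n⇒m<n {m} {n} m<m⊔n with ≤-total n m
... | inj₁ n≤m = ⊥-elim (<-irrefl (sym (m≥n⇒m⊔n≡m n≤m)) m<m⊔n)
... | inj₂ m≤n = <-≤-trans m<m⊔n (≤-reflexive (m≤n⇒m⊔n≡n m≤n))

≤ᵥ-refl : ∀ {n} (u : Vec ℕ n) → u ≤ᵥ u
≤ᵥ-refl u i = ≤-refl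

≤ᵥ-antisym : ∀ {n} (u v : Vec ℕ n) → u ≤ᵥ v → v ≤ᵥ u → u ≡ v
≤ᵥ-antisym u v u≤v v≤u = begin
  u                   ≡⟨ tabulate∘lookup u ⟨
  tabulate (lookup u) ≡⟨ tabulate-cong (λ i → ≤-antisym (u≤v i) (v≤u i)) ⟩
  tabulate (lookup v) ≡⟨ tabulate∘lookup v ⟩
  v                   ∎
  where open ≡-Reasoning

_≤ᵥ?_ : ∀ {n} (u v : Vec ℕ n) → Dec (u ≤ᵥ v)
u ≤ᵥ? v = Fin.all? (λ i → lookup u i ≤? lookup v i)

≰ᵥ⇒∃> : ∀ {n} (u v : Vec ℕ n) → ¬ u ≤ᵥ v → ∃[ i ] lookup v i < lookup u i
≰ᵥ⇒∃> {n} u v u≰v =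
  let i , ui≰vi = ¬∀⟶∃¬ n _ (λ i → lookup u i ≤? lookup v i) u≰v in i , ≰⇒> ui≰vi

<ᵥ⇒∃< : ∀ {n} (u v : Vec ℕ n) → u <ᵥ v → ∃[ i ] lookup u i < lookup v i
<ᵥ⇒∃< u v (u≤v , u≢v) with v ≤ᵥ? u
... | yes v≤u = ⊥-elim (u≢v (≤ᵥ-antisym u v u≤v v≤u))
... | no  v≰u = ≰ᵥ⇒∃> v u v≰u

lookup-∨ᵥ : ∀ {n} (u v : Vec ℕ n) i → lookup (u ∨ᵥ v) i ≡ lookup u i ⊔ lookup v i
lookup-∨ᵥ u v i = lookup-zipWith _⊔_ i u v

u≤u∨ᵥv : ∀ {n} (u v : Vec ℕ n) → u ≤ᵥ (u ∨ᵥ v)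
u≤u∨ᵥv u v i = ≤-trans (m≤m⊔n _ _) (≤-reflexive (sym (lookup-∨ᵥ u v i)))

v≤u∨ᵥv : ∀ {n} (u v : Vec ℕ n) → v ≤ᵥ (u ∨ᵥ v)
v≤u∨ᵥv u v i = ≤-trans (m≤n⊔m _ _) (≤-reflexive (sym (lookup-∨ᵥ u v i)))

_∧ᵥ_ : ∀ {n} → Vec ℕ n → Vec ℕ n → Vec ℕ n
u ∧ᵥ v = zipWith _⊓_ u v

lookup-∧ᵥ : ∀ {n} (u v : Vec ℕ n) i → lookup (u ∧ᵥ v) i ≡ lookup u i ⊓ lookup v i
lookup-∧ᵥ u v i = lookup-zipWith _⊓_ i u v

u∧ᵥv≤u : ∀ {n} (u v : Vec ℕ n) → (u ∧ᵥ v) ≤ᵥ u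
u∧ᵥv≤u u v i = ≤-trans (≤-reflexive (lookup-∧ᵥ u v i)) (m⊓n≤m _ _)

u∧ᵥv≤v : ∀ {n} (u v : Vec ℕ n) → (u ∧ᵥ v) ≤ᵥ v
u∧ᵥv≤v u v i = ≤-trans (≤-reflexive (lookup-∧ᵥ u v i)) (m⊓n≤n _ _)

0ᵥ : ∀ {n} → Vec ℕ n
0ᵥ {n} = replicate n 0

inc dec : ∀ {n} → Vec ℕ n → Fin n → Vec ℕ n
inc u i = updateAt u i suc
dec u i = updateAt u i pred

lookup-inc : ∀ {n} (u : Vec ℕ n) i → lookup (inc u i) i ≡ suc (lookup u i)
lookup-inc u i = lookup∘updateAt i u

lookup-dec : ∀ {n} (u : Vec ℕ n) i → lookup (dec u i) i ≡ pred (lookup u i)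
lookup-dec u i = lookup∘updateAt i u

lookup-updateAt′ : ∀ {n} {f : ℕ → ℕ} (u : Vec ℕ n) {i j} → j ≢ i →
                   lookup (updateAt u i f) j ≡ lookup u j
lookup-updateAt′ u {i} {j} j≢i = lookup∘updateAt′ j i j≢i u

u≤inc : ∀ {n} (u : Vec ℕ n) i → u ≤ᵥ inc u i
u≤inc u i j with j ≟ i
... | yes refl = ≤-trans (n≤1+n _) (≤-reflexive (sym (lookup-inc u i)))
... | no  j≢i  = ≤-reflexive (sym (lookup-updateAt′ u j≢i))

dec≤u : ∀ {n} (u : Vec ℕ n) i → dec u i ≤ᵥ u
dec≤u u i j with j ≟ i
... | yes refl = ≤-trans (≤-reflexive (lookup-dec u i)) pred[n]≤n
... | no  j≢i  = ≤-reflexive (lookup-updateAt′ u j≢i)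

suc-lookup-dec : ∀ {n} (u : Vec ℕ n) {i} → 0 < lookup u i → suc (lookup (dec u i) i) ≡ lookup u i
suc-lookup-dec u {i} ui>0 = trans (cong suc (lookup-dec u i)) (suc-pred (lookup u i) {{>-nonZero ui>0}})

dec-<ᵢ : ∀ {n} (u : Vec ℕ n) {i} → 0 < lookup u i → lookup (dec u i) i < lookup u i
dec-<ᵢ u ui>0 = ≤-reflexive (suc-lookup-dec u ui>0)

dec<u : ∀ {n} (u : Vec ℕ n) {i} → 0 < lookup u i → dec u i <ᵥ u
dec<u u {i} ui>0 = dec≤u u i , λ eq → <-irrefl (cong (λ w → lookup w i) eq) (dec-<ᵢ u ui>0)

∣_∣ : ∀ {n} → Vec ℕ n → ℕ
∣ u ∣ = sum (lookup u)

move : ∀ {n} → Vec ℕ n → Fin n → Fin n → Vec ℕ n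
move u j i = inc (dec u j) i

lookup-move-to : ∀ {n} (u : Vec ℕ n) {j i} → j ≢ i → lookup (move u j i) i ≡ suc (lookup u i)
lookup-move-to u {j} {i} j≢i =
  trans (lookup-inc (dec u j) i) (cong suc (lookup-updateAt′ u (j≢i ∘ sym)))

move-<-from : ∀ {n} (u : Vec ℕ n) {j i} → j ≢ i → 0 < lookup u j →
              lookup (move u j i) j < lookup u j
move-<-from u {j} j≢i uj>0 =
  ≤-<-trans (≤-reflexive (lookup-updateAt′ (dec u j) j≢i)) (dec-<ᵢ u uj>0)

move≤ : ∀ {n} (u : Vec ℕ n) j {i h} → h ≢ i → lookup (move u j i) h ≤ lookup u h
move≤ u j h≢i = ≤-trans (≤-reflexive (lookup-updateAt′ (dec u j) h≢i)) (dec≤u u j _)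

move≤inc : ∀ {n} (u : Vec ℕ n) j i → move u j i ≤ᵥ inc u i
move≤inc u j i h with h ≟ i
... | yes refl = ≤-trans (≤-reflexive (lookup-inc (dec u j) i))
                   (≤-trans (s≤s (dec≤u u j i)) (≤-reflexive (sym (lookup-inc u i))))
... | no  h≢i  = ≤-trans (move≤ u j h≢i) (u≤inc u i h)

∣∣-mono-< : ∀ {n} {u v : Vec ℕ n} → u <ᵥ v → ∣ u ∣ < ∣ v ∣
∣∣-mono-< {u = u} {v} u<v = let i , ui<vi = <ᵥ⇒∃< u v u<v in sum-mono-< i (proj₁ u<v) ui<vi

∣updateAt∣ : ∀ {n} (u : Vec ℕ n) i (f : ℕ → ℕ) →
             ∣ updateAt u i f ∣ + lookup u i ≡ ∣ u ∣ + f (lookup u i)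
∣updateAt∣ u i f =
  trans (sum-exchange _ _ i (λ k → lookup-updateAt′ u)) (cong (∣ u ∣ +_) (lookup∘updateAt i u))

inc≤ : ∀ {n} (u v : Vec ℕ n) i → u ≤ᵥ v → lookup u i < lookup v i → inc u i ≤ᵥ v
inc≤ u v i u≤v ui<vi k with k ≟ i
... | yes refl = ≤-trans (≤-reflexive (lookup-inc u i)) ui<vi
... | no  k≢i  = ≤-trans (≤-reflexive (lookup-updateAt′ u k≢i)) (u≤v k)

move≤ᵥ : ∀ {n} (u v : Vec ℕ n) j i → u ≤ᵥ v → lookup u i < lookup v i → move u j i ≤ᵥ v
move≤ᵥ u v j i u≤v ui<vi k = ≤-trans (move≤inc u j i k) (inc≤ u v i u≤v ui<vi k)

private
  exchange-suc : ∀ {a b x} → a + x ≡ b + suc x → a ≡ suc b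
  exchange-suc {a} {b} {x} eq = +-cancelʳ-≡ x a (suc b) (trans eq (+-suc b x))

  exchange-pred : ∀ {a b x} → 0 < x → a + x ≡ b + pred x → b ≡ suc a
  exchange-pred {a} {b} {suc x} _ eq = +-cancelʳ-≡ x b (suc a) (trans (sym eq) (+-suc a x))

∣inc∣ : ∀ {n} (u : Vec ℕ n) i → ∣ inc u i ∣ ≡ suc ∣ u ∣
∣inc∣ u i = exchange-suc (∣updateAt∣ u i suc)

∣dec∣ : ∀ {n} (u : Vec ℕ n) {i} → 0 < lookup u i → ∣ u ∣ ≡ suc ∣ dec u i ∣
∣dec∣ u {i} ui>0 = exchange-pred ui>0 (∣updateAt∣ u i pred)

∣move∣ : ∀ {n} (u : Vec ℕ n) {j} i → 0 < lookup u j → ∣ move u j i ∣ ≡ ∣ u ∣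
∣move∣ u {j} i uj>0 = trans (∣inc∣ (dec u j) i) (sym (∣dec∣ u uj>0))

vectorsBelow : ∀ {n} → Vec ℕ n → List (Vec ℕ n)
vectorsBelow []      = [] ∷ []
vectorsBelow (k ∷ m) = cartesianProductWith _∷_ (upTo (suc k)) (vectorsBelow m)

∈-vectorsBelow : ∀ {n} (m u : Vec ℕ n) → u ≤ᵥ m → u ∈ vectorsBelow m
∈-vectorsBelow []      []      _   = here refl
∈-vectorsBelow (k ∷ m) (x ∷ u) u≤m =
  ∈-cartesianProductWith⁺ _∷_ (∈-upTo⁺ (s≤s (u≤m zero))) (∈-vectorsBelow m u (u≤m ∘ suc))

if-mono : ∀ b {x y} → x ≤ y → (if b then x else 0) ≤ (if b then y else 0)
if-mono true  x≤y = x≤y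
if-mono false _   = z≤n

if-≤ : ∀ b x → (if b then x else 0) ≤ x
if-≤ true  x = ≤-refl
if-≤ false x = z≤n

if-implies : ∀ {a b} x → (a ≡ true → b ≡ true) → (if a then x else 0) ≤ (if b then x else 0)
if-implies {true}  x a⇒b rewrite a⇒b refl = ≤-refl
if-implies {false} x a⇒b = z≤n

if-false : ∀ b x → (b ≡ true → ⊥) → (if b then x else 0) ≡ 0
if-false true  x b≢true = ⊥-elim (b≢true refl)
if-false false x b≢true = refl

if-∨-∧ : ∀ a b x → (if a ∨ b then x else 0) + (if a ∧ b then x else 0)
                  ≡ (if a then x else 0) + (if b then x else 0)
if-∨-∧ true  true  x = refl
if-∨-∧ true  false x = refl
if-∨-∧ false true  x = +-comm x 0
if-∨-∧ false false x = refl

if-∨-∧-⊔-⊓ : ∀ a b x y → (if a then x else 0) + (if b then y else 0)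
                        ≤ (if a ∨ b then x ⊔ y else 0) + (if a ∧ b then x ⊓ y else 0)
if-∨-∧-⊔-⊓ true  true  x y = ≤-reflexive (+≡⊔+⊓ x y)
  where
  +≡⊔+⊓ : ∀ x y → x + y ≡ x ⊔ y + x ⊓ y
  +≡⊔+⊓ x y with ≤-total x y
  ... | inj₁ x≤y rewrite m≤n⇒m⊔n≡n x≤y | m≤n⇒m⊓n≡m x≤y = +-comm x y
  ... | inj₂ y≤x rewrite m≥n⇒m⊔n≡m y≤x | m≥n⇒m⊓n≡n y≤x = refl
if-∨-∧-⊔-⊓ true  false x y = +-monoˡ-≤ 0 (m≤m⊔n x y)
if-∨-∧-⊔-⊓ false true  x y = ≤-trans (≤-reflexive (+-comm 0 y)) (+-monoˡ-≤ 0 (m≤n⊔m x y))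
if-∨-∧-⊔-⊓ false false x y = z≤n

_↾_ : ∀ {n} → Vec ℕ n → Subset n → Fin n → ℕ
(u ↾ X) k = if lookup X k then lookup u k else 0

↾-∈ : ∀ {n} (u : Vec ℕ n) {X k} → k ∈ₛ X → (u ↾ X) k ≡ lookup u k
↾-∈ u {k = k} k∈X = cong (λ b → if b then lookup u k else 0) ([]=⇒lookup k∈X)

↾-∉ : ∀ {n} (u : Vec ℕ n) {X k} → k ∉ X → (u ↾ X) k ≡ 0
↾-∉ u {X} {k} k∉X = if-false (lookup X k) (lookup u k) (k∉X ∘ lookup⇒[]= k X)

sumOn-↾ : ∀ {n} (X : Subset n) u → sumOn X u ≡ sum (u ↾ X)
sumOn-↾ []          []      = refl
sumOn-↾ (true ∷ X)  (x ∷ u) = cong (x +_) (sumOn-↾ X u)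
sumOn-↾ (false ∷ X) (x ∷ u) = sumOn-↾ X u

sumOn-monoʳ : ∀ {n} (X : Subset n) {u v} → u ≤ᵥ v → sumOn X u ≤ sumOn X v
sumOn-monoʳ X {u} {v} u≤v rewrite sumOn-↾ X u | sumOn-↾ X v =
  sum-mono-≤ (λ k → if-mono (lookup X k) (u≤v k))

sumOn-monoˡ : ∀ {n} {X Y : Subset n} u → X ⊆ Y → sumOn X u ≤ sumOn Y u
sumOn-monoˡ {X = X} {Y} u X⊆Y rewrite sumOn-↾ X u | sumOn-↾ Y u =
  sum-mono-≤ (λ k → if-implies (lookup u k) (λ k∈X → []=⇒lookup (X⊆Y (lookup⇒[]= k X k∈X))))

sumOn-∪-∩ : ∀ {n} (X Y : Subset n) u → sumOn (X ∪ Y) u + sumOn (X ∩ Y) u ≡ sumOn X u + sumOn Y u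
sumOn-∪-∩ X Y u rewrite sumOn-↾ (X ∪ Y) u | sumOn-↾ (X ∩ Y) u | sumOn-↾ X u | sumOn-↾ Y u = begin
  sum (u ↾ (X ∪ Y)) + sum (u ↾ (X ∩ Y))          ≡⟨ ∑-distrib-+ (u ↾ (X ∪ Y)) (u ↾ (X ∩ Y)) ⟨
  sum (λ k → (u ↾ (X ∪ Y)) k + (u ↾ (X ∩ Y)) k)  ≡⟨ sum-cong-≗ pointwise ⟩
  sum (λ k → (u ↾ X) k + (u ↾ Y) k)              ≡⟨ ∑-distrib-+ (u ↾ X) (u ↾ Y) ⟩
  sum (u ↾ X) + sum (u ↾ Y)                      ∎
  where
  open ≡-Reasoning
  pointwise : ∀ k → (u ↾ (X ∪ Y)) k + (u ↾ (X ∩ Y)) k ≡ (u ↾ X) k + (u ↾ Y) k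
  pointwise k = trans (cong₂ (λ a b → (if a then lookup u k else 0) + (if b then lookup u k else 0))
                             (lookup-zipWith _∨_ k X Y) (lookup-zipWith _∧_ k X Y))
                      (if-∨-∧ (lookup X k) (lookup Y k) (lookup u k))

sumOn-∨-∧ : ∀ {n} (X Y : Subset n) u v →
            sumOn X u + sumOn Y v ≤ sumOn (X ∪ Y) (u ∨ᵥ v) + sumOn (X ∩ Y) (u ∧ᵥ v)
sumOn-∨-∧ X Y u v
  rewrite sumOn-↾ X u | sumOn-↾ Y v | sumOn-↾ (X ∪ Y) (u ∨ᵥ v) | sumOn-↾ (X ∩ Y) (u ∧ᵥ v) = begin
  sum (u ↾ X) + sum (v ↾ Y)                                    ≡⟨ ∑-distrib-+ (u ↾ X) (v ↾ Y) ⟨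
  sum (λ k → (u ↾ X) k + (v ↾ Y) k)                            ≤⟨ sum-mono-≤ pointwise ⟩
  sum (λ k → ((u ∨ᵥ v) ↾ (X ∪ Y)) k + ((u ∧ᵥ v) ↾ (X ∩ Y)) k)  ≡⟨ ∑-distrib-+ ((u ∨ᵥ v) ↾ (X ∪ Y)) _ ⟩
  sum ((u ∨ᵥ v) ↾ (X ∪ Y)) + sum ((u ∧ᵥ v) ↾ (X ∩ Y))          ∎
  where
  open ≤-Reasoning
  pointwise : ∀ k → (u ↾ X) k + (v ↾ Y) k
                  ≤ ((u ∨ᵥ v) ↾ (X ∪ Y)) k + ((u ∧ᵥ v) ↾ (X ∩ Y)) k
  pointwise k rewrite lookup-zipWith _∨_ k X Y | lookup-zipWith _∧_ k X Y
                    | lookup-∨ᵥ u v k | lookup-∧ᵥ u v k =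
    if-∨-∧-⊔-⊓ (lookup X k) (lookup Y k) (lookup u k) (lookup v k)

sumOn-⁅⁆ : ∀ {n} (i : Fin n) u → sumOn ⁅ i ⁆ u ≡ lookup u i
sumOn-⁅⁆ i u = begin
  sumOn ⁅ i ⁆ u     ≡⟨ sumOn-↾ ⁅ i ⁆ u ⟩
  sum (u ↾ ⁅ i ⁆)   ≡⟨ sum-single (u ↾ ⁅ i ⁆) i (λ k k≢i → ↾-∉ u (k≢i ∘ x∈⁅y⁆⇒x≡y i)) ⟩
  (u ↾ ⁅ i ⁆) i     ≡⟨ ↾-∈ u (x∈⁅x⁆ i) ⟩
  lookup u i        ∎
  where open ≡-Reasoning

sumOn-vanishing : ∀ {n} (X : Subset n) u → (∀ k → k ∈ₛ X → lookup u k ≡ 0) → sumOn X u ≡ 0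
sumOn-vanishing X u u≡0 = trans (sumOn-↾ X u) (sum-zero (u ↾ X) pointwise)
  where
  pointwise : ∀ k → (u ↾ X) k ≡ 0
  pointwise k with k ∈? X
  ... | yes k∈X = trans (↾-∈ u k∈X) (u≡0 k k∈X)
  ... | no  k∉X = ↾-∉ u k∉X

sumOn-cong-zeros : ∀ {n} (X Y : Subset n) u →
                   (∀ k → k ∈ₛ X → k ∉ Y → lookup u k ≡ 0) →
                   (∀ k → k ∈ₛ Y → k ∉ X → lookup u k ≡ 0) →
                   sumOn X u ≡ sumOn Y u
sumOn-cong-zeros X Y u X-Y Y-X rewrite sumOn-↾ X u | sumOn-↾ Y u = sum-cong-≗ pointwise
  where
  pointwise : ∀ k → (u ↾ X) k ≡ (u ↾ Y) k
  pointwise k with k ∈? X | k ∈? Y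
  ... | yes k∈X | yes k∈Y = trans (↾-∈ u k∈X) (sym (↾-∈ u k∈Y))
  ... | yes k∈X | no  k∉Y = trans (↾-∈ u k∈X) (trans (X-Y k k∈X k∉Y) (sym (↾-∉ u k∉Y)))
  ... | no  k∉X | yes k∈Y = trans (↾-∉ u k∉X) (trans (sym (Y-X k k∈Y k∉X)) (sym (↾-∈ u k∈Y)))
  ... | no  k∉X | no  k∉Y = trans (↾-∉ u k∉X) (sym (↾-∉ u k∉Y))

sumOn-updateAt : ∀ {n} (X : Subset n) u i (f : ℕ → ℕ) →
                 sumOn X (updateAt u i f) + (u ↾ X) i ≡ sumOn X u + (updateAt u i f ↾ X) i
sumOn-updateAt X u i f rewrite sumOn-↾ X u | sumOn-↾ X (updateAt u i f) =
  sum-exchange _ _ i (λ k k≢i → cong (λ x → if lookup X k then x else 0) (lookup-updateAt′ u k≢i))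

sumOn-updateAt-∈ : ∀ {n} {X : Subset n} u {i} (f : ℕ → ℕ) → i ∈ₛ X →
                   sumOn X (updateAt u i f) + lookup u i ≡ sumOn X u + f (lookup u i)
sumOn-updateAt-∈ {X = X} u {i} f i∈X = begin
  sumOn X (updateAt u i f) + lookup u i         ≡⟨ cong (sumOn X (updateAt u i f) +_) (↾-∈ u i∈X) ⟨
  sumOn X (updateAt u i f) + (u ↾ X) i          ≡⟨ sumOn-updateAt X u i f ⟩
  sumOn X u + (updateAt u i f ↾ X) i            ≡⟨ cong (sumOn X u +_) (↾-∈ (updateAt u i f) i∈X) ⟩
  sumOn X u + lookup (updateAt u i f) i         ≡⟨ cong (sumOn X u +_) (lookup∘updateAt i u) ⟩
  sumOn X u + f (lookup u i)                    ∎
  where open ≡-Reasoning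

sumOn-updateAt-∉ : ∀ {n} {X : Subset n} u {i} (f : ℕ → ℕ) → i ∉ X →
                   sumOn X (updateAt u i f) ≡ sumOn X u
sumOn-updateAt-∉ {X = X} u {i} f i∉X = begin
  sumOn X (updateAt u i f)                      ≡⟨ +-identityʳ _ ⟨
  sumOn X (updateAt u i f) + 0                  ≡⟨ cong (sumOn X (updateAt u i f) +_) (↾-∉ u i∉X) ⟨
  sumOn X (updateAt u i f) + (u ↾ X) i          ≡⟨ sumOn-updateAt X u i f ⟩
  sumOn X u + (updateAt u i f ↾ X) i            ≡⟨ cong (sumOn X u +_) (↾-∉ (updateAt u i f) i∉X) ⟩
  sumOn X u + 0                                 ≡⟨ +-identityʳ _ ⟩
  sumOn X u                                     ∎
  where open ≡-Reasoning

restrict : ∀ {n} → Subset n → Vec ℕ n → Vec ℕ n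
restrict X u = tabulate (u ↾ X)

restrict≤ : ∀ {n} (X : Subset n) u → restrict X u ≤ᵥ u
restrict≤ X u k = ≤-trans (≤-reflexive (lookup∘tabulate (u ↾ X) k)) (if-≤ (lookup X k) (lookup u k))

∣restrict∣ : ∀ {n} (X : Subset n) u → ∣ restrict X u ∣ ≡ sumOn X u
∣restrict∣ X u = trans (sum-cong-≗ (lookup∘tabulate (u ↾ X))) (sym (sumOn-↾ X u))

restrict-∉ : ∀ {n} (X : Subset n) u k → k ∉ X → lookup (restrict X u) k ≡ 0
restrict-∉ X u k k∉X = trans (lookup∘tabulate (u ↾ X) k) (↾-∉ u k∉X)

∣∣≡sumOn : ∀ {n} (X : Subset n) u → (∀ k → k ∉ X → lookup u k ≡ 0) → ∣ u ∣ ≡ sumOn X u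
∣∣≡sumOn X u u≡0 = trans (sum-cong-≗ pointwise) (sym (sumOn-↾ X u))
  where
  pointwise : ∀ k → lookup u k ≡ (u ↾ X) k
  pointwise k with k ∈? X
  ... | yes k∈X = sym (↾-∈ u k∈X)
  ... | no  k∉X = trans (u≡0 k k∉X) (sym (↾-∉ u k∉X))

sumOn-inc : ∀ {n} {X : Subset n} u {i} → i ∈ₛ X → sumOn X (inc u i) ≡ suc (sumOn X u)
sumOn-inc u i∈X = exchange-suc (sumOn-updateAt-∈ u suc i∈X)

sumOn-dec : ∀ {n} {X : Subset n} u {i} → i ∈ₛ X → 0 < lookup u i →
            sumOn X u ≡ suc (sumOn X (dec u i))
sumOn-dec u i∈X ui>0 = exchange-pred ui>0 (sumOn-updateAt-∈ u pred i∈X)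

support : ∀ {n} → Vec ℕ n → Subset n
support u = tabulate (λ k → 0 <ᵇ lookup u k)

∉support : ∀ {n} (u : Vec ℕ n) {k} → k ∉ support u → lookup u k ≡ 0
∉support u {k} k∉supp with lookup u k in uk≡
... | zero  = refl
... | suc _ = ⊥-elim (k∉supp (lookup⇒[]= k (support u)
                               (trans (lookup∘tabulate _ k) (cong (0 <ᵇ_) uk≡))))

∈support⇒0< : ∀ {n} (u : Vec ℕ n) {k} → k ∈ₛ support u → 0 < lookup u k
∈support⇒0< u {k} k∈supp =
  0<ᵇ⇒0< (lookup u k) (trans (sym (lookup∘tabulate _ k)) ([]=⇒lookup k∈supp))
  where
  0<ᵇ⇒0< : ∀ x → (0 <ᵇ x) ≡ true → 0 < x
  0<ᵇ⇒0< (suc x) _ = s≤s z≤n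

-- Independence and circuits for an arbitrary set function

module _ {n} (ρ : Subset n → ℕ) where

  Independent-≤ᵥ : ∀ {u v} → u ≤ᵥ v → Independent ρ v → Independent ρ u
  Independent-≤ᵥ u≤v v-ind X = ≤-trans (sumOn-monoʳ X u≤v) (v-ind X)

  violated? : ∀ u → Dec (∃[ X ] ρ X < sumOn X u)
  violated? u = anySubset? (λ X → ρ X <? sumOn X u)

  independent? : ∀ u → Dec (Independent ρ u)
  independent? u with violated? u
  ... | yes (X , viol) = no (λ u-ind → <⇒≱ viol (u-ind X))
  ... | no  ¬viol      = yes (λ X → ≮⇒≥ (λ viol → ¬viol (X , viol)))

  dependent⇒violated : ∀ {u} → ¬ Independent ρ u → ∃[ X ] ρ X < sumOn X u
  dependent⇒violated {u} dep with violated? u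
  ... | yes viol = viol
  ... | no  ¬viol = ⊥-elim (dep (λ X → ≮⇒≥ (λ viol → ¬viol (X , viol))))

module _ {n} {ρ : Subset n → ℕ} {C : List (Vec ℕ n)} (circ : CircuitsAre ρ C) where

  -- Minimality of u is only refuted, not decided, so the descent yields a double negation;
  -- the circuit itself is then found by searching the finite list C.
  private
    ¬¬circuit≤ : ∀ u → Acc _<_ ∣ u ∣ → InBox ρ u → ¬ Independent ρ u → ¬ ¬ Any (_≤ᵥ u) C
    ¬¬circuit≤ u (acc rs) box dep none =
      none (lose (proj₂ (circ u) (box , dep , minimal)) (≤ᵥ-refl u))
      where
      minimal : ∀ w → w <ᵥ u → Independent ρ w
      minimal w w<u = decidable-stable (independent? ρ w) λ w-dep →
        ¬¬circuit≤ w (rs (∣∣-mono-< w<u)) (λ i → ≤-trans (proj₁ w<u i) (box i)) w-dep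
          (none ∘ Any.map (λ c≤w i → ≤-trans (c≤w i) (proj₁ w<u i)))

  dependent⇒circuit≤ : ∀ {u} → InBox ρ u → ¬ Independent ρ u → ∃[ c ] (c ∈ C × c ≤ᵥ u)
  dependent⇒circuit≤ {u} box dep =
    find (decidable-stable (Any.any? (_≤ᵥ? u) C) (¬¬circuit≤ u (<-wellFounded ∣ u ∣) box dep))

-- Circuits of an integer polymatroid satisfy (C1)–(C4)

module CircuitAxioms {n} {ρ : Subset n → ℕ} (poly : IsIntPolymatroid ρ)
                     {C : List (Vec ℕ n)} (circ : CircuitsAre ρ C) where
  open IsIntPolymatroid poly

  circuit-inBox : ∀ {u} → u ∈ C → InBox ρ u
  circuit-inBox u∈C = proj₁ (proj₁ (circ _) u∈C)

  circuit-dependent : ∀ {u} → u ∈ C → ¬ Independent ρ u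
  circuit-dependent u∈C = proj₁ (proj₂ (proj₁ (circ _) u∈C))

  circuit-minimal : ∀ {u} → u ∈ C → ∀ w → w <ᵥ u → Independent ρ w
  circuit-minimal u∈C = proj₂ (proj₂ (proj₁ (circ _) u∈C))

  circuit-≮ : ∀ {u v} → u ∈ C → v ∈ C → ¬ u <ᵥ v
  circuit-≮ u∈C v∈C u<v = circuit-dependent u∈C (circuit-minimal v∈C _ u<v)

  c2 : C2 C
  c2 u v u∈C v∈C _ = circuit-≮ u∈C v∈C , circuit-≮ v∈C u∈C

  single-support-independent : ∀ {u} i → InBox ρ u → (∀ k → k ≢ i → lookup u k ≡ 0) →
                               Independent ρ u
  single-support-independent {u} i box u≡0 X with i ∈? X
  ... | no  i∉X =
    ≤-trans (≤-reflexive (sumOn-vanishing X u (λ k k∈X → u≡0 k (λ { refl → i∉X k∈X })))) z≤n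
  ... | yes i∈X = begin
    sumOn X u      ≡⟨ sumOn-cong-zeros X ⁅ i ⁆ u (λ k _ k∉⁅i⁆ → u≡0 k (λ { refl → k∉⁅i⁆ (x∈⁅x⁆ i) }))
                                                 (λ k k∈⁅i⁆ k∉X → ⊥-elim (k∉X (⁅i⁆⊆X k∈⁅i⁆))) ⟩
    sumOn ⁅ i ⁆ u  ≡⟨ sumOn-⁅⁆ i u ⟩
    lookup u i     ≤⟨ box i ⟩
    ρ ⁅ i ⁆        ≤⟨ monotone ⁅ i ⁆ X ⁅i⁆⊆X ⟩
    ρ X            ∎
    where
    open ≤-Reasoning
    ⁅i⁆⊆X : ⁅ i ⁆ ⊆ X
    ⁅i⁆⊆X k∈⁅i⁆ rewrite x∈⁅y⁆⇒x≡y i k∈⁅i⁆ = i∈X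

  c1 : C1 C
  c1 u u∈C = decidable-stable two-positive? (circuit-dependent u∈C ∘ independent)
    where
    TwoPositive = Σ (Fin n) λ i → Σ (Fin n) λ j → i ≢ j × 0 < lookup u i × 0 < lookup u j
    two-positive? : Dec TwoPositive
    two-positive? = Fin.any? λ i → Fin.any? λ j →
      ¬? (i ≟ j) ×-dec 0 <? lookup u i ×-dec 0 <? lookup u j
    independent : ¬ TwoPositive → Independent ρ u
    independent ¬two with Fin.any? (λ i → 0 <? lookup u i)
    ... | no  none       = λ X → ≤-trans (≤-reflexive (sumOn-vanishing X u
                             (λ k _ → n≤0⇒n≡0 (≮⇒≥ (none ∘ (k ,_)))))) z≤n
    ... | yes (i , ui>0) = single-support-independent i (circuit-inBox u∈C)
                             (λ k k≢i → n≤0⇒n≡0 (≮⇒≥ (λ uk>0 → ¬two (k , i , k≢i , uk>0 , ui>0))))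

  circuit-violated-set : ∀ {u} → u ∈ C →
                         ∃[ X ] ((∀ k → 0 < lookup u k → k ∈ₛ X) × ρ X < sumOn X u)
  circuit-violated-set {u} u∈C =
    let X , viol = dependent⇒violated ρ (circuit-dependent u∈C) in X , covers X viol , viol
    where
    -- Lowering u at a coordinate outside X leaves the violated sum intact.
    covers : ∀ X → ρ X < sumOn X u → ∀ k → 0 < lookup u k → k ∈ₛ X
    covers X viol k uk>0 = decidable-stable (k ∈? X) λ k∉X → <⇒≱ viol
      (subst (_≤ ρ X) (sumOn-updateAt-∉ u pred k∉X)
                      (circuit-minimal u∈C (dec u k) (dec<u u uk>0) X))

  circuits-∧ᵥ-independent : ∀ {u v} → u ∈ C → v ∈ C → u ≢ v → Independent ρ (u ∧ᵥ v)
  circuits-∧ᵥ-independent {u} {v} u∈C v∈C u≢v with ≡-dec _≟ℕ_ (u ∧ᵥ v) u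
  ... | no  u∧v≢u = circuit-minimal u∈C _ (u∧ᵥv≤u u v , u∧v≢u)
  ... | yes u∧v≡u = ⊥-elim (circuit-≮ u∈C v∈C (u≤v , u≢v))
    where
    u≤v : u ≤ᵥ v
    u≤v k = subst (λ w → lookup w k ≤ lookup v k) u∧v≡u (u∧ᵥv≤v u v k)

  lowered-join-dependent : ∀ {u v X Y i} → u ∈ C → v ∈ C → u ≢ v → i ∈ₛ X ∪ Y →
                           0 < lookup (u ∨ᵥ v) i → ρ X < sumOn X u → ρ Y < sumOn Y v →
                           ¬ Independent ρ (dec (u ∨ᵥ v) i)
  lowered-join-dependent {u} {v} {X} {Y} {i} u∈C v∈C u≢v i∈X∪Y Ji>0 violX violY w-ind =
    1+n≰n (begin
      suc (suc (ρ X + ρ Y))                          ≡⟨ cong suc (+-suc (ρ X) (ρ Y)) ⟨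
      suc (ρ X) + suc (ρ Y)                          ≤⟨ +-mono-≤ violX violY ⟩
      sumOn X u + sumOn Y v                          ≤⟨ sumOn-∨-∧ X Y u v ⟩
      sumOn (X ∪ Y) J + sumOn (X ∩ Y) (u ∧ᵥ v)        ≡⟨ cong (_+ sumOn (X ∩ Y) (u ∧ᵥ v))
                                                            (sumOn-dec J i∈X∪Y Ji>0) ⟩
      suc (sumOn (X ∪ Y) (dec J i) + sumOn (X ∩ Y) (u ∧ᵥ v))
                                                     ≤⟨ s≤s (+-mono-≤ (w-ind (X ∪ Y)) ∧-ind) ⟩
      suc (ρ (X ∪ Y) + ρ (X ∩ Y))                    ≤⟨ s≤s (submodular X Y) ⟩
      suc (ρ X + ρ Y)                                ∎)
    where
    open ≤-Reasoning
    J = u ∨ᵥ v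
    ∧-ind = circuits-∧ᵥ-independent u∈C v∈C u≢v (X ∩ Y)

  c3 : C3 C
  c3 u v u∈C v∈C u≢v i ui>0 vi>0
    with circuit-violated-set u∈C | circuit-violated-set v∈C
  ... | X , supp-u⊆X , violX | Y , _ , violY
    with dependent⇒circuit≤ circ w-inBox
           (lowered-join-dependent u∈C v∈C u≢v (x∈p∪q⁺ (inj₁ (supp-u⊆X i ui>0))) Ji>0 violX violY)
    where
    J = u ∨ᵥ v
    Ji>0 : 0 < lookup J i
    Ji>0 = <-≤-trans ui>0 (u≤u∨ᵥv u v i)
    w-inBox : InBox ρ (dec J i)
    w-inBox k = ≤-trans (dec≤u J i k)
      (≤-trans (≤-reflexive (lookup-∨ᵥ u v k)) (⊔-lub (circuit-inBox u∈C k) (circuit-inBox v∈C k)))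
  ... | z , z∈C , z≤w = z , z∈C , (z≤J , z≢J) , zi<
    where
    J = u ∨ᵥ v
    z≤J : z ≤ᵥ J
    z≤J k = ≤-trans (z≤w k) (dec≤u J i k)
    zi<Ji : lookup z i < lookup J i
    zi<Ji = ≤-<-trans (z≤w i) (dec-<ᵢ J (<-≤-trans ui>0 (u≤u∨ᵥv u v i)))
    z≢J : z ≢ J
    z≢J z≡J = <-irrefl (cong (λ x → lookup x i) z≡J) zi<Ji
    zi< : lookup z i < lookup u i ⊔ lookup v i
    zi< = <-≤-trans zi<Ji (≤-reflexive (lookup-∨ᵥ u v i))

  move-dependent : ∀ {u X i j} → i ∈ₛ X → j ∈ₛ X → 0 < lookup u j → ρ X < sumOn X u →
                   ¬ Independent ρ (move u j i)
  move-dependent {u} {X} {i} {j} i∈X j∈X uj>0 viol w-ind = <⇒≱ viol (begin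
    sumOn X u                 ≡⟨ sumOn-dec u j∈X uj>0 ⟩
    suc (sumOn X (dec u j))   ≡⟨ sumOn-inc (dec u j) i∈X ⟨
    sumOn X (move u j i)      ≤⟨ w-ind X ⟩
    ρ X                       ∎)
    where open ≤-Reasoning

  c4 : ∀ m → (∀ i → (∃[ u ] (u ∈ C × 0 < lookup u i)) → ∃[ u ] (u ∈ C × lookup u i ≡ lookup m i)) →
       C4 m C
  c4 m attained u u∈C i ui>0 ui<mi j j≢i uj>0 with circuit-violated-set u∈C
  ... | X , supp-u⊆X , viol
    with dependent⇒circuit≤ circ w-inBox
           (move-dependent (supp-u⊆X i ui>0) (supp-u⊆X j uj>0) uj>0 viol)
    where
    mi≤ρi : lookup m i ≤ ρ ⁅ i ⁆
    mi≤ρi = let c , c∈C , ci≡mi = attained i (u , u∈C , ui>0) in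
            subst (_≤ ρ ⁅ i ⁆) ci≡mi (circuit-inBox c∈C i)
    w-inBox : InBox ρ (move u j i)
    w-inBox h with h ≟ i
    ... | yes refl = ≤-trans (≤-reflexive (lookup-move-to u j≢i)) (≤-trans ui<mi mi≤ρi)
    ... | no  h≢i  = ≤-trans (move≤ u j h≢i) (circuit-inBox u∈C h)
  ... | z , z∈C , z≤w = z , z∈C , zi≡ , (λ h h≢i → ≤-trans (z≤w h) (move≤ u j h≢i)) , zj<uj
    where
    zj<uj : lookup z j < lookup u j
    zj<uj = ≤-<-trans (z≤w j) (move-<-from u j≢i uj>0)
    zi≡ : lookup z i ≡ suc (lookup u i)
    zi≡ with lookup z i ≤? lookup u i
    ... | no  zi≰ui = ≤-antisym (≤-trans (z≤w i) (≤-reflexive (lookup-move-to u j≢i))) (≰⇒> zi≰ui)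
    ... | yes zi≤ui = ⊥-elim (circuit-≮ z∈C u∈C (z≤u , z≢u))
      where
      z≤u : z ≤ᵥ u
      z≤u h with h ≟ i
      ... | yes refl = zi≤ui
      ... | no  h≢i  = ≤-trans (z≤w h) (move≤ u j h≢i)
      z≢u : z ≢ u
      z≢u z≡u = <-irrefl (cong (λ x → lookup x j) z≡u) zj<uj

-- Tight independent vectors

x∉p-x : ∀ {n} (p : Subset n) x → x ∉ p - x
x∉p-x (s ∷ p) zero    ()
x∉p-x (s ∷ p) (suc x) (there x∈p-x) = x∉p-x p x x∈p-x

module Greedy {n} {ρ : Subset n → ℕ} (poly : IsIntPolymatroid ρ) where
  open IsIntPolymatroid poly

  submodular-cover : ∀ {X Y Z} → X ⊆ Z ∪ Y → ρ X + ρ (Z ∩ Y) ≤ ρ Z + ρ Y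
  submodular-cover {X} {Y} {Z} X⊆Z∪Y = ≤-trans (+-monoˡ-≤ _ (monotone X (Z ∪ Y) X⊆Z∪Y)) (submodular Z Y)

  Tight : Subset n → Set
  Tight X = ∃[ u ] (Independent ρ u × sumOn X u ≡ ρ X × (∀ k → k ∉ X → lookup u k ≡ 0))

  tight-empty : ∀ {X} → Empty X → Tight X
  tight-empty {X} X-empty =
    0ᵥ , (λ Z → ≤-trans (≤-reflexive (sumOn-vanishing Z 0ᵥ zeros)) z≤n) ,
    trans (sumOn-vanishing X 0ᵥ zeros) (sym (trans (cong ρ (Empty-unique X-empty)) empty)) ,
    (λ k _ → lookup-replicate k 0)
    where
    zeros : ∀ {Z} k → k ∈ₛ Z → lookup 0ᵥ k ≡ 0
    zeros k _ = lookup-replicate k 0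

  tight-insert : ∀ {X i} → i ∈ₛ X → Tight (X - i) → Tight X
  tight-insert {X} {i} i∈X (w , w-ind , w-tight , w-supp) = u , u-ind , u-tight , u-supp
    where
    Y = X - i
    wi≡0 : lookup w i ≡ 0
    wi≡0 = w-supp i (x∉p-x X i)
    ρY≤ρX : ρ Y ≤ ρ X
    ρY≤ρX = monotone Y X (p─q⊆p X ⁅ i ⁆)
    d = ρ X ∸ ρ Y
    u = w [ i ]≔ d
    raise : ∀ {Z} → i ∈ₛ Z → sumOn Z u ≡ sumOn Z w + d
    raise {Z} i∈Z = trans (sym (+-identityʳ _))
      (trans (cong (sumOn Z u +_) (sym wi≡0)) (sumOn-updateAt-∈ w (λ _ → d) i∈Z))
    u-tight : sumOn X u ≡ ρ X
    u-tight = begin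
      sumOn X u        ≡⟨ raise i∈X ⟩
      sumOn X w + d    ≡⟨ cong (_+ d) (sumOn-cong-zeros X Y w (λ k _ k∉Y → w-supp k k∉Y)
                                        (λ k k∈Y k∉X → ⊥-elim (k∉X (p─q⊆p X ⁅ i ⁆ k∈Y)))) ⟩
      sumOn Y w + d    ≡⟨ cong (_+ d) w-tight ⟩
      ρ Y + d          ≡⟨ m+[n∸m]≡n ρY≤ρX ⟩
      ρ X              ∎
      where open ≡-Reasoning
    u-supp : ∀ k → k ∉ X → lookup u k ≡ 0
    u-supp k k∉X = trans (lookup-updateAt′ w (λ { refl → k∉X i∈X })) (w-supp k (k∉X ∘ p─q⊆p X ⁅ i ⁆))
    u-ind : Independent ρ u
    u-ind Z with i ∈? Z
    ... | no  i∉Z = subst (_≤ ρ Z) (sym (sumOn-updateAt-∉ w (λ _ → d) i∉Z)) (w-ind Z)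
    ... | yes i∈Z = +-cancelʳ-≤ (ρ Y) _ _ (begin
      sumOn Z u + ρ Y          ≡⟨ cong (_+ ρ Y) (raise i∈Z) ⟩
      sumOn Z w + d + ρ Y      ≡⟨ +-assoc (sumOn Z w) d (ρ Y) ⟩
      sumOn Z w + (d + ρ Y)    ≡⟨ cong (sumOn Z w +_) (m∸n+n≡m ρY≤ρX) ⟩
      sumOn Z w + ρ X          ≡⟨ cong (_+ ρ X) (sumOn-cong-zeros Z (Z ∩ Y) w
                                   (λ k k∈Z k∉Z∩Y → w-supp k (λ k∈Y → k∉Z∩Y (x∈p∩q⁺ (k∈Z , k∈Y))))
                                   (λ k k∈Z∩Y k∉Z → ⊥-elim (k∉Z (p∩q⊆p Z Y k∈Z∩Y)))) ⟩
      sumOn (Z ∩ Y) w + ρ X    ≤⟨ +-monoˡ-≤ (ρ X) (w-ind (Z ∩ Y)) ⟩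
      ρ (Z ∩ Y) + ρ X          ≡⟨ +-comm _ (ρ X) ⟩
      ρ X + ρ (Z ∩ Y)          ≤⟨ submodular-cover X⊆Z∪Y ⟩
      ρ Z + ρ Y                ∎)
      where
      open ≤-Reasoning
      X⊆Z∪Y : X ⊆ Z ∪ Y
      X⊆Z∪Y {k} k∈X with k ≟ i
      ... | yes refl = x∈p∪q⁺ (inj₁ i∈Z)
      ... | no  k≢i  = x∈p∪q⁺ (inj₂ (x∈p∧x≢y⇒x∈p-y k∈X k≢i))

  tight : ∀ X → Tight X
  tight X = go X (<-wellFounded ∣ X ∣ₛ)
    where
    go : ∀ X → Acc _<_ ∣ X ∣ₛ → Tight X
    go X (acc rs) with nonempty? X
    ... | no  X-empty   = tight-empty X-empty
    ... | yes (i , i∈X) = tight-insert i∈X (go (X - i) (rs (x∈p⇒∣p-x∣<∣p∣ i∈X)))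

-- The polymatroid with circuit set C

module FromCircuits {n} (m : Vec ℕ n) (C : List (Vec ℕ n)) (C≤m : ∀ u → u ∈ C → u ≤ᵥ m)
                    (c1 : C1 C) (c2 : C2 C) (c3 : C3 C) (c4 : C4 m C) where

  record Indep (u : Vec ℕ n) : Set where
    constructor indep
    field
      ≤m   : u ≤ᵥ m
      free : ∀ c → c ∈ C → ¬ c ≤ᵥ u
  open Indep

  indep? : ∀ u → Dec (Indep u)
  indep? u with u ≤ᵥ? m | All.all? (λ c → ¬? (c ≤ᵥ? u)) C
  ... | yes u≤m | yes all-free = yes (indep u≤m (λ c c∈C → All.lookup all-free c∈C))
  ... | no  u≰m | _            = no (u≰m ∘ ≤m)
  ... | _       | no  ¬all     = no (λ Iu → ¬all (All.tabulate (free Iu _)))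

  Indep-≤ᵥ : ∀ {u v} → u ≤ᵥ v → Indep v → Indep u
  Indep-≤ᵥ u≤v Iv = indep (λ i → ≤-trans (u≤v i) (≤m Iv i))
                          (λ c c∈C c≤u → free Iv c c∈C (λ i → ≤-trans (c≤u i) (u≤v i)))

  Indep-restrict : ∀ X {u} → Indep u → Indep (restrict X u)
  Indep-restrict X {u} = Indep-≤ᵥ (restrict≤ X u)

  ¬Indep⇒circuit≤ : ∀ {u} → u ≤ᵥ m → ¬ Indep u → ∃[ c ] (c ∈ C × c ≤ᵥ u)
  ¬Indep⇒circuit≤ {u} u≤m ¬Iu = find (decidable-stable (Any.any? (_≤ᵥ? u) C)
    (λ none → ¬Iu (indep u≤m (λ c c∈C c≤u → none (lose c∈C c≤u)))))

  Indep-0ᵥ : Indep 0ᵥ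
  Indep-0ᵥ = indep (λ i → ≤-trans (≤-reflexive (lookup-replicate i 0)) z≤n) λ c c∈C c≤0 →
    let i , _ , _ , ci>0 , _ = c1 c c∈C
    in <-irrefl refl (<-≤-trans ci>0 (≤-trans (c≤0 i) (≤-reflexive (lookup-replicate i 0))))

  Indep-dec : ∀ {c j} → c ∈ C → 0 < lookup c j → Indep (dec c j)
  Indep-dec {c} {j} c∈C cj>0 = indep (λ i → ≤-trans (dec≤u c j i) (C≤m c c∈C i)) λ c′ c′∈C c′≤ →
    let c′≢c : c′ ≢ c
        c′≢c eq = <-irrefl (cong (λ x → lookup x j) eq) (≤-<-trans (c′≤ j) (dec-<ᵢ c cj>0))
    in proj₁ (c2 c′ c c′∈C c∈C c′≢c) ((λ i → ≤-trans (c′≤ i) (dec≤u c j i)) , c′≢c)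

  circuit≰ : ∀ {u c} → Indep u → c ∈ C → ¬ c ≤ᵥ u
  circuit≰ Iu c∈C = free Iu _ c∈C

  private
    ≤inc⇒≤ : ∀ (c w : Vec ℕ n) {e h} → c ≤ᵥ inc w e → h ≢ e → lookup c h ≤ lookup w h
    ≤inc⇒≤ c w {h = h} c≤ h≢e = ≤-trans (c≤ h) (≤-reflexive (lookup-updateAt′ w h≢e))

  -- For independent w, at most one member of C lies below w + eₑ (its fundamental circuit),
  -- and it agrees with w + eₑ on its support.
  circuit≤inc-at : ∀ {w c e} → Indep w → c ∈ C → c ≤ᵥ inc w e → lookup c e ≡ suc (lookup w e)
  circuit≤inc-at {w} {c} {e} Iw c∈C c≤ with lookup c e ≤? lookup w e
  ... | no  ce≰we = ≤-antisym (≤-trans (c≤ e) (≤-reflexive (lookup-inc w e))) (≰⇒> ce≰we)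
  ... | yes ce≤we = ⊥-elim (circuit≰ Iw c∈C c≤w)
    where
    c≤w : c ≤ᵥ w
    c≤w h with h ≟ e
    ... | yes refl = ce≤we
    ... | no  h≢e  = ≤inc⇒≤ c w c≤ h≢e

  circuit≤inc-tight : ∀ {w c e g} → Indep w → c ∈ C → c ≤ᵥ inc w e → g ≢ e → 0 < lookup c g →
                      lookup c g ≡ lookup w g
  circuit≤inc-tight {w} {c} {e} {g} Iw c∈C c≤ g≢e cg>0 with lookup c g <? lookup w g
  ... | no  cg≮wg = ≤-antisym (≤inc⇒≤ c w c≤ g≢e) (≮⇒≥ cg≮wg)
  ... | yes cg<wg with c4 c c∈C g cg>0 (<-≤-trans cg<wg (≤m Iw g)) e (g≢e ∘ sym) ce>0
    where
    ce>0 : 0 < lookup c e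
    ce>0 = ≤-<-trans z≤n (≤-reflexive (sym (circuit≤inc-at Iw c∈C c≤)))
  ... | v , v∈C , vg≡ , v≤c , ve<ce = ⊥-elim (circuit≰ Iw v∈C v≤w)
    where
    v≤w : v ≤ᵥ w
    v≤w h with h ≟ g | h ≟ e
    ... | yes refl | _        = ≤-trans (≤-reflexive vg≡) cg<wg
    ... | no  h≢g  | yes refl = s≤s⁻¹ (<-≤-trans ve<ce (≤-reflexive (circuit≤inc-at Iw c∈C c≤)))
    ... | no  h≢g  | no  h≢e  = ≤-trans (v≤c h h≢g) (≤inc⇒≤ c w c≤ h≢e)

  circuit≤inc-unique : ∀ {w c c′ e} → Indep w → c ∈ C → c′ ∈ C → c ≤ᵥ inc w e → c′ ≤ᵥ inc w e →
                       c ≡ c′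
  circuit≤inc-unique {w} {c} {c′} {e} Iw c∈C c′∈C c≤ c′≤ with ≡-dec _≟ℕ_ c c′
  ... | yes c≡c′ = c≡c′
  ... | no  c≢c′ with c3 c c′ c∈C c′∈C c≢c′ e (positive c∈C c≤) (positive c′∈C c′≤)
    where
    positive : ∀ {d} → d ∈ C → d ≤ᵥ inc w e → 0 < lookup d e
    positive d∈C d≤ = ≤-<-trans z≤n (≤-reflexive (sym (circuit≤inc-at Iw d∈C d≤)))
  ... | z , z∈C , (z≤c∨c′ , _) , ze< = ⊥-elim (circuit≰ Iw z∈C z≤w)
    where
    z≤w : z ≤ᵥ w
    z≤w h with h ≟ e
    ... | yes refl = s≤s⁻¹ (<-≤-trans ze< (≤-reflexive (begin-equality
      lookup c h ⊔ lookup c′ h              ≡⟨ cong₂ _⊔_ (circuit≤inc-at Iw c∈C c≤) (circuit≤inc-at Iw c′∈C c′≤) ⟩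
      suc (lookup w h) ⊔ suc (lookup w h)   ≡⟨ ⊔-idem _ ⟩
      suc (lookup w h)                      ∎)))
      where open ≤-Reasoning
    ... | no  h≢e  = ≤-trans (z≤c∨c′ h) (≤-trans (≤-reflexive (lookup-∨ᵥ c c′ h))
                                           (⊔-lub (≤inc⇒≤ c w c≤ h≢e) (≤inc⇒≤ c′ w c′≤ h≢e)))

  module Augment {u v : Vec ℕ n} (Iu : Indep u) (Iv : Indep v) where

    J : Vec ℕ n
    J = u ∨ᵥ v

    Augmentation : Set
    Augmentation = ∃[ i ] (lookup u i < lookup v i × Indep (inc u i))

    excess : Vec ℕ n → ℕ
    excess w = sum (λ k → lookup u k ∸ lookup w k)

    excess-move : ∀ w {e g} → g ≢ e → lookup w e < lookup u e → lookup u g < lookup w g →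
                  excess (move w g e) < excess w
    excess-move w {e} {g} g≢e we<ue ug<wg = sum-mono-< e pointwise
      (subst (λ x → lookup u e ∸ x < lookup u e ∸ lookup w e) (sym (lookup-move-to w g≢e))
             (∸-monoʳ-< (n<1+n _) we<ue))
      where
      pointwise : ∀ k → lookup u k ∸ lookup (move w g e) k ≤ lookup u k ∸ lookup w k
      pointwise k with k ≟ e | k ≟ g
      ... | yes refl | _        =
        ∸-monoʳ-≤ (lookup u k) (≤-trans (n≤1+n _) (≤-reflexive (sym (lookup-move-to w g≢e))))
      ... | no  k≢e  | yes refl = ≤-trans (≤-reflexive (m≤n⇒m∸n≡0 ug≤moveg)) z≤n
        where
        ug≤moveg : lookup u k ≤ lookup (move w k e) k
        ug≤moveg = ≤-trans (<⇒≤pred ug<wg)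
                     (≤-reflexive (sym (trans (lookup-updateAt′ (dec w k) k≢e) (lookup-dec w k))))
      ... | no  k≢e  | no  k≢g  = ≤-reflexive (cong (lookup u k ∸_)
                                    (trans (lookup-updateAt′ (dec w g) k≢e) (lookup-updateAt′ w k≢g)))

    move≤m : ∀ {w e} → Indep w → lookup w e < lookup u e → ∀ g → move w g e ≤ᵥ m
    move≤m {w} {e} Iw we<ue g = move≤ᵥ w m g e (≤m Iw) (<-≤-trans we<ue (≤m Iu e))

    -- Moving a unit from f to a deficient coordinate e of w either stays independent, or
    -- creates the unique circuit c below w + eₑ; a coordinate g where c exceeds u is then a
    -- source that works.
    exchange : ∀ {w e f} → Indep w → lookup w e < lookup u e → lookup u f < lookup w f →
               ∃[ g ] (g ≢ e × lookup u g < lookup w g × Indep (move w g e))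
    exchange {w} {e} {f} Iw we<ue uf<wf with indep? (move w f e)
    ... | yes I = f , f≢e , uf<wf , I
      where
      f≢e : f ≢ e
      f≢e refl = <-asym we<ue uf<wf
    ... | no ¬I with ¬Indep⇒circuit≤ (move≤m Iw we<ue f) ¬I
    ...   | c , c∈C , c≤ with ≰ᵥ⇒∃> c u (circuit≰ Iu c∈C)
    ...     | g , ug<cg = g , g≢e , ug<wg , decidable-stable (indep? (move w g e)) c-unique
      where
      c≤inc : c ≤ᵥ inc w e
      c≤inc k = ≤-trans (c≤ k) (move≤inc w f e k)
      g≢e : g ≢ e
      g≢e refl = <-irrefl refl
        (<-≤-trans ug<cg (≤-trans (≤-reflexive (circuit≤inc-at Iw c∈C c≤inc)) we<ue))
      cg≡wg : lookup c g ≡ lookup w g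
      cg≡wg = circuit≤inc-tight Iw c∈C c≤inc g≢e (≤-<-trans z≤n ug<cg)
      ug<wg : lookup u g < lookup w g
      ug<wg = <-≤-trans ug<cg (≤-reflexive cg≡wg)
      c-unique : ¬ ¬ Indep (move w g e)
      c-unique ¬I′ =
        let c′ , c′∈C , c′≤ = ¬Indep⇒circuit≤ (move≤m Iw we<ue g) ¬I′
            c′≤inc : c′ ≤ᵥ inc w e
            c′≤inc k = ≤-trans (c′≤ k) (move≤inc w g e k)
        in <-irrefl (cong (λ x → lookup x g) (circuit≤inc-unique Iw c′∈C c∈C c′≤inc c≤inc))
             (≤-<-trans (c′≤ g) (<-≤-trans (move-<-from w g≢e (≤-<-trans z≤n ug<wg))
                                           (≤-reflexive (sym cg≡wg))))

    -- Exchanges keep ∣ w ∣ and strictly decrease the excess of u over w, until u ≤ w.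
    augment-from : ∀ w → Acc _<_ (excess w) → Indep w → w ≤ᵥ J → ∣ u ∣ < ∣ w ∣ → Augmentation
    augment-from w (acc rs) Iw w≤J ∣u∣<∣w∣ with u ≤ᵥ? w | sum-<⇒∃< (lookup u) (lookup w) ∣u∣<∣w∣
    ... | yes u≤w | i , ui<wi =
      i , m<m⊔n⇒m<n (<-≤-trans ui<wi (≤-trans (w≤J i) (≤-reflexive (lookup-∨ᵥ u v i)))) ,
      Indep-≤ᵥ (inc≤ u w i u≤w ui<wi) Iw
    ... | no  u≰w | f , uf<wf with ≰ᵥ⇒∃> u w u≰w
    ...   | e , we<ue with exchange Iw we<ue uf<wf
    ...     | g , g≢e , ug<wg , I′ =
      augment-from (move w g e) (rs (excess-move w g≢e we<ue ug<wg)) I′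
        (move≤ᵥ w J g e w≤J (<-≤-trans we<ue (u≤u∨ᵥv u v e)))
        (<-≤-trans ∣u∣<∣w∣ (≤-reflexive (sym (∣move∣ w e (≤-<-trans z≤n ug<wg)))))

    augment : ∣ u ∣ < ∣ v ∣ → Augmentation
    augment = augment-from v (<-wellFounded (excess v)) Iv (v≤u∨ᵥv u v)

  extend : ∀ {u v} → Indep u → Indep v →
           ∃[ x ] (Indep x × u ≤ᵥ x × x ≤ᵥ (u ∨ᵥ v) × ∣ v ∣ ≤ ∣ x ∣)
  extend {u} {v} Iu Iv = go u (<-wellFounded (∣ v ∣ ∸ ∣ u ∣)) Iu (≤ᵥ-refl u) (u≤u∨ᵥv u v)
    where
    go : ∀ x → Acc _<_ (∣ v ∣ ∸ ∣ x ∣) → Indep x → u ≤ᵥ x → x ≤ᵥ (u ∨ᵥ v) →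
         ∃[ x ] (Indep x × u ≤ᵥ x × x ≤ᵥ (u ∨ᵥ v) × ∣ v ∣ ≤ ∣ x ∣)
    go x (acc rs) Ix u≤x x≤J with ∣ v ∣ ≤? ∣ x ∣
    ... | yes ∣v∣≤∣x∣ = x , Ix , u≤x , x≤J , ∣v∣≤∣x∣
    ... | no  ∣v∣≰∣x∣ with Augment.augment Ix Iv (≰⇒> ∣v∣≰∣x∣)
    ...   | i , xi<vi , Ix′ =
      go (inc x i) (rs (subst (λ s → ∣ v ∣ ∸ s < ∣ v ∣ ∸ ∣ x ∣) (sym (∣inc∣ x i))
                         (∸-monoʳ-< (n<1+n _) (≰⇒> ∣v∣≰∣x∣))))
         Ix′ (λ k → ≤-trans (u≤x k) (u≤inc x i k))
         (inc≤ x (u ∨ᵥ v) i x≤J (<-≤-trans xi<vi (v≤u∨ᵥv u v i)))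

  independents : List (Vec ℕ n)
  independents = filter indep? (vectorsBelow m)

  best : Subset n → Vec ℕ n
  best X = argmax (sumOn X) 0ᵥ independents

  ρ : Subset n → ℕ
  ρ X = sumOn X (best X)

  Indep-best : ∀ X → Indep (best X)
  Indep-best X = argmax-all (sumOn X) Indep-0ᵥ (all-filter indep? (vectorsBelow m))

  sumOn≤ρ : ∀ X {u} → Indep u → sumOn X u ≤ ρ X
  sumOn≤ρ X {u} Iu = All.lookup (f[xs]≤f[argmax] {f = sumOn X} 0ᵥ independents)
                                (∈-filter⁺ indep? (∈-vectorsBelow m u (≤m Iu)) Iu)

  -- Extend the restriction p of best (A ∩ B) by the restriction q of best (A ∪ B); the result
  -- x is supported in A ∪ B, lies above p and is at least as large as q.
  ρ-submodular : ∀ A B → ρ (A ∪ B) + ρ (A ∩ B) ≤ ρ A + ρ B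
  ρ-submodular A B with extend (Indep-restrict (A ∩ B) (Indep-best (A ∩ B)))
                               (Indep-restrict (A ∪ B) (Indep-best (A ∪ B)))
  ... | x , Ix , p≤x , x≤p∨q , ∣q∣≤∣x∣ = begin
    ρ (A ∪ B) + ρ (A ∩ B)              ≡⟨ cong₂ _+_ (∣restrict∣ (A ∪ B) b∪) (∣restrict∣ (A ∩ B) b∩) ⟨
    ∣ q ∣ + ∣ p ∣                       ≤⟨ +-mono-≤ ∣q∣≤∣x∣ (≤-reflexive (∣∣≡sumOn (A ∩ B) p p-supp)) ⟩
    ∣ x ∣ + sumOn (A ∩ B) p            ≤⟨ +-mono-≤ (≤-reflexive (∣∣≡sumOn (A ∪ B) x x-supp))
                                                  (sumOn-monoʳ (A ∩ B) p≤x) ⟩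
    sumOn (A ∪ B) x + sumOn (A ∩ B) x  ≡⟨ sumOn-∪-∩ A B x ⟩
    sumOn A x + sumOn B x              ≤⟨ +-mono-≤ (sumOn≤ρ A Ix) (sumOn≤ρ B Ix) ⟩
    ρ A + ρ B                          ∎
    where
    open ≤-Reasoning
    b∩ = best (A ∩ B)
    b∪ = best (A ∪ B)
    p = restrict (A ∩ B) b∩
    q = restrict (A ∪ B) b∪
    p-supp : ∀ k → k ∉ A ∩ B → lookup p k ≡ 0
    p-supp = restrict-∉ (A ∩ B) b∩
    x-supp : ∀ k → k ∉ A ∪ B → lookup x k ≡ 0
    x-supp k k∉A∪B = n≤0⇒n≡0 (≤-trans (x≤p∨q k) (≤-trans (≤-reflexive (lookup-∨ᵥ p q k))
      (⊔-lub (≤-reflexive (p-supp k (k∉A∪B ∘ x∈p∪q⁺ ∘ inj₁ ∘ p∩q⊆p A B)))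
             (≤-reflexive (restrict-∉ (A ∪ B) b∪ k k∉A∪B)))))

  ρ-polymatroid : IsIntPolymatroid ρ
  ρ-polymatroid = record
    { empty      = sumOn-vanishing ∅ (best ∅) (λ k k∈∅ → ⊥-elim (∉⊥ k∈∅))
    ; monotone   = λ A B A⊆B → ≤-trans (sumOn-monoˡ (best A) A⊆B) (sumOn≤ρ B (Indep-best A))
    ; submodular = ρ-submodular
    }

  ρ-singleton : ∀ i → ρ ⁅ i ⁆ ≡ lookup m i
  ρ-singleton i = ≤-antisym
    (≤-trans (≤-reflexive (sumOn-⁅⁆ i (best ⁅ i ⁆))) (≤m (Indep-best ⁅ i ⁆) i))
    (≤-trans (≤-reflexive (sym mᵢ-sum)) (sumOn≤ρ ⁅ i ⁆ Indep-mᵢ))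
    where
    mᵢ = 0ᵥ [ i ]≔ lookup m i
    mᵢ-off : ∀ {k} → k ≢ i → lookup mᵢ k ≡ 0
    mᵢ-off {k} k≢i = trans (lookup-updateAt′ 0ᵥ k≢i) (lookup-replicate k 0)
    mᵢ-sum : sumOn ⁅ i ⁆ mᵢ ≡ lookup m i
    mᵢ-sum = trans (sumOn-⁅⁆ i mᵢ) (lookup∘updateAt i 0ᵥ)
    -- Below mᵢ lies no vector with two positive entries, hence no member of C.
    Indep-mᵢ : Indep mᵢ
    Indep-mᵢ = indep mᵢ≤m λ c c∈C c≤mᵢ →
      let a , b , a≢b , ca>0 , cb>0 = c1 c c∈C
          zero-off : ∀ {k} → k ≢ i → 0 < lookup c k → ⊥
          zero-off {k} k≢i ck>0 =
            <-irrefl refl (<-≤-trans ck>0 (≤-trans (c≤mᵢ k) (≤-reflexive (mᵢ-off k≢i))))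
      in case a ≟ i of λ where
           (yes refl) → zero-off (a≢b ∘ sym) cb>0
           (no a≢i)   → zero-off a≢i ca>0
      where
      mᵢ≤m : mᵢ ≤ᵥ m
      mᵢ≤m k with k ≟ i
      ... | yes refl = ≤-reflexive (lookup∘updateAt i 0ᵥ)
      ... | no  k≢i  = ≤-trans (≤-reflexive (mᵢ-off k≢i)) z≤n

  Indep⇒independent : ∀ {u} → Indep u → Independent ρ u
  Indep⇒independent Iu X = sumOn≤ρ X Iu

  dec-circuit-saturated : ∀ {c j x} → c ∈ C → 0 < lookup c j → Indep x → dec c j ≤ᵥ x →
                          ∀ i → 0 < lookup c i → lookup x i ≤ lookup (dec c j) i
  dec-circuit-saturated {c} {j} {x} c∈C cj>0 Ix c′≤x i ci>0
    with lookup x i ≤? lookup (dec c j) i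
  ... | yes xi≤c′i = xi≤c′i
  ... | no  xi≰c′i with i ≟ j
  ...   | yes refl = ⊥-elim (circuit≰ Ix c∈C c≤x)
    where
    c≤x : c ≤ᵥ x
    c≤x h with h ≟ i
    ... | yes refl = ≤-trans (≤-reflexive (sym (suc-lookup-dec c cj>0))) (≰⇒> xi≰c′i)
    ... | no  h≢i  = ≤-trans (≤-reflexive (sym (lookup-updateAt′ c h≢i))) (c′≤x h)
  ...   | no  i≢j with c4 c c∈C i ci>0 ci<mi j (i≢j ∘ sym) cj>0
    where
    ci<mi : lookup c i < lookup m i
    ci<mi = <-≤-trans (≤-<-trans (≤-reflexive (sym (lookup-updateAt′ c i≢j))) (≰⇒> xi≰c′i))
                      (≤m Ix i)
  ...     | v , v∈C , vi≡ , v≤c , vj<cj = ⊥-elim (circuit≰ Ix v∈C v≤x)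
    where
    v≤x : v ≤ᵥ x
    v≤x h with h ≟ i | h ≟ j
    ... | yes refl | _        =
      ≤-trans (≤-reflexive (trans vi≡ (cong suc (sym (lookup-updateAt′ c i≢j))))) (≰⇒> xi≰c′i)
    ... | no  h≢i  | yes refl =
      ≤-trans (≤-trans (<⇒≤pred vj<cj) (≤-reflexive (sym (lookup-dec c h)))) (c′≤x h)
    ... | no  h≢i  | no  h≢j  =
      ≤-trans (v≤c h h≢i) (≤-trans (≤-reflexive (sym (lookup-updateAt′ c h≢j))) (c′≤x h))

  -- If c were independent, extending c − eⱼ by the restriction b of best (support c) would
  -- exceed c − eⱼ somewhere on the support of c.
  circuit-dependent : ∀ {c} → c ∈ C → ¬ Independent ρ c
  circuit-dependent {c} c∈C c-ind with c1 c c∈C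
  ... | j , _ , _ , cj>0 , _
    with extend (Indep-dec c∈C cj>0) (Indep-restrict (support c) (Indep-best (support c)))
  ... | x , Ix , c′≤x , x≤c′∨b , ∣b∣≤∣x∣ with sum-<⇒∃< (lookup (dec c j)) (lookup x) ∣c′∣<∣x∣
    where
    S = support c
    ∣c′∣<∣x∣ : ∣ dec c j ∣ < ∣ x ∣
    ∣c′∣<∣x∣ = begin-strict
      ∣ dec c j ∣                  <⟨ n<1+n _ ⟩
      suc ∣ dec c j ∣              ≡⟨ ∣dec∣ c cj>0 ⟨
      ∣ c ∣                        ≡⟨ ∣∣≡sumOn S c (λ k → ∉support c) ⟩
      sumOn S c                    ≤⟨ c-ind S ⟩
      ρ S                          ≡⟨ ∣restrict∣ S (best S) ⟨
      ∣ restrict S (best S) ∣      ≤⟨ ∣b∣≤∣x∣ ⟩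
      ∣ x ∣                        ∎
      where open ≤-Reasoning
  ... | i , c′i<xi = <⇒≱ c′i<xi (dec-circuit-saturated c∈C cj>0 Ix c′≤x i (∈support⇒0< c i∈S))
    where
    S = support c
    b = restrict S (best S)
    c′i<bi : lookup (dec c j) i < lookup b i
    c′i<bi = m<m⊔n⇒m<n (<-≤-trans c′i<xi (≤-trans (x≤c′∨b i) (≤-reflexive (lookup-∨ᵥ (dec c j) b i))))
    i∈S : i ∈ₛ S
    i∈S = decidable-stable (i ∈? S) λ i∉S →
      <-irrefl (sym (restrict-∉ S (best S) i i∉S)) (≤-<-trans z≤n c′i<bi)

  ρ-circuits : CircuitsAre ρ C
  ρ-circuits u = member⇒circuit , circuit⇒member
    where
    member⇒circuit : u ∈ C → IsCircuit ρ u
    member⇒circuit u∈C = inBox , circuit-dependent u∈C , minimal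
      where
      inBox : InBox ρ u
      inBox i = ≤-trans (C≤m u u∈C i) (≤-reflexive (sym (ρ-singleton i)))
      minimal : ∀ w → w <ᵥ u → Independent ρ w
      minimal w (w≤u , w≢u) =
        Indep⇒independent (indep (λ i → ≤-trans (w≤u i) (C≤m u u∈C i)) below-w)
        where
        below-w : ∀ c → c ∈ C → ¬ c ≤ᵥ w
        below-w c c∈C c≤w with ≡-dec _≟ℕ_ c u
        ... | yes refl = w≢u (≤ᵥ-antisym w c w≤u c≤w)
        ... | no  c≢u  = proj₁ (c2 c u c∈C u∈C c≢u) ((λ i → ≤-trans (c≤w i) (w≤u i)) , c≢u)
    circuit⇒member : IsCircuit ρ u → u ∈ C
    circuit⇒member (inBox , dep , minimal)
      with ¬Indep⇒circuit≤ (λ i → ≤-trans (inBox i) (≤-reflexive (ρ-singleton i)))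
                           (dep ∘ Indep⇒independent)
    ... | c , c∈C , c≤u with ≡-dec _≟ℕ_ c u
    ...   | yes refl = c∈C
    ...   | no  c≢u  = ⊥-elim (circuit-dependent c∈C (minimal c (c≤u , c≢u)))

  -- Both polymatroids have the same independent vectors, and by the greedy construction every
  -- value ρ′ X is attained by one of them.
  ρ-unique : ∀ ρ′ → IsIntPolymatroid ρ′ → (∀ i → ρ′ ⁅ i ⁆ ≡ lookup m i) → CircuitsAre ρ′ C →
             ∀ X → ρ′ X ≡ ρ X
  ρ-unique ρ′ poly′ singleton′ circuits′ X with Greedy.tight poly′ X
  ... | u , u-ind , u-tight , _ = ≤-antisym
    (≤-trans (≤-reflexive (sym u-tight)) (sumOn≤ρ X (independent′⇒Indep u-ind)))
    (Indep⇒independent′ (Indep-best X) X)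
    where
    Indep⇒independent′ : ∀ {w} → Indep w → Independent ρ′ w
    Indep⇒independent′ {w} Iw = decidable-stable (independent? ρ′ w) λ dep →
      let c , c∈C , c≤w = dependent⇒circuit≤ circuits′
                            (λ i → ≤-trans (≤m Iw i) (≤-reflexive (sym (singleton′ i)))) dep
      in circuit≰ Iw c∈C c≤w
    independent′⇒Indep : ∀ {w} → Independent ρ′ w → Indep w
    independent′⇒Indep {w} w-ind = indep
      (λ i → ≤-trans (≤-reflexive (sym (sumOn-⁅⁆ i w))) (≤-trans (w-ind ⁅ i ⁆) (≤-reflexive (singleton′ i))))
      (λ c c∈C c≤w → circuit-dependent′ c∈C (Independent-≤ᵥ ρ′ c≤w w-ind))
      where open CircuitAxioms poly′ circuits′ using () renaming (circuit-dependent to circuit-dependent′)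

polymatroid⇒circuit-axioms : ∀ {n} (m : Vec ℕ n) {C : List (Vec ℕ n)} →
  (∀ i → (∃[ u ] (u ∈ C × 0 < lookup u i)) → ∃[ u ] (u ∈ C × lookup u i ≡ lookup m i)) →
  ∃[ ρ ] (IsIntPolymatroid ρ × CircuitsAre ρ C) → C1 C × C2 C × C3 C × C4 m C
polymatroid⇒circuit-axioms m attained (ρ , poly , circ) = c1 , c2 , c3 , c4 m attained
  where open CircuitAxioms poly circ

circuit-axioms⇒unique-polymatroid : ∀ {n} (m : Vec ℕ n) C → (∀ u → u ∈ C → u ≤ᵥ m) →
  C1 C × C2 C × C3 C × C4 m C →
  Σ (Subset n → ℕ) λ ρ →
    (IsIntPolymatroid ρ × (∀ i → ρ ⁅ i ⁆ ≡ lookup m i) × CircuitsAre ρ C)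
    × (∀ ρ′ → IsIntPolymatroid ρ′ → (∀ i → ρ′ ⁅ i ⁆ ≡ lookup m i) → CircuitsAre ρ′ C →
         ∀ X → ρ′ X ≡ ρ X)
circuit-axioms⇒unique-polymatroid m C C≤m (c1 , c2 , c3 , c4) =
  ρ , (ρ-polymatroid , ρ-singleton , ρ-circuits) , ρ-unique
  where open FromCircuits m C C≤m c1 c2 c3 c4

theorem4p3 : (n : ℕ) → 1 ≤ n → (m : Vec ℕ n) → (C : List (Vec ℕ n)) →
    (∀ u → u ∈ C → u ≤ᵥ m) →
    (∀ i → (∃[ u ] (u ∈ C × 0 < lookup u i)) → ∃[ u ] (u ∈ C × lookup u i ≡ lookup m i)) →
    (((∃[ ρ ] (IsIntPolymatroid ρ × CircuitsAre ρ C)) → C1 C × C2 C × C3 C × C4 m C)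
     × (C1 C × C2 C × C3 C × C4 m C → ∃[ ρ ] (IsIntPolymatroid ρ × CircuitsAre ρ C)))
    × (C1 C × C2 C × C3 C × C4 m C →
       Σ (Subset n → ℕ) λ ρ →
         (IsIntPolymatroid ρ × (∀ i → ρ ⁅ i ⁆ ≡ lookup m i) × CircuitsAre ρ C)
         × (∀ ρ′ → IsIntPolymatroid ρ′ → (∀ i → ρ′ ⁅ i ⁆ ≡ lookup m i) → CircuitsAre ρ′ C →
              ∀ X → ρ′ X ≡ ρ X))
theorem4p3 n _ m C C≤m attained =
  (polymatroid⇒circuit-axioms m attained , polymatroid) , circuit-axioms⇒unique-polymatroid m C C≤m
  where
  polymatroid : C1 C × C2 C × C3 C × C4 m C → ∃[ ρ ] (IsIntPolymatroid ρ × CircuitsAre ρ C)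
  polymatroid axioms =
    let ρ , (poly , _ , circ) , _ = circuit-axioms⇒unique-polymatroid m C C≤m axioms in ρ , poly , circ
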